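{- Let $G$ be a multigraph and suppose there is a positive integer $d$ such that $d$ divides $d_G(v)$ for every vertex $v\in V(G)$ but $d$ does not divide $|E(G)|$. Then $G$ has no interval coloring.
   Context: Multigraphs are finite and may have multiple edges but no loops; $d_G(v)$ denotes the degree of $v$. An interval coloring of a multigraph $G$ is a proper edge coloring with colors $1,\dots,t$ for some positive integer $t$, every color used, such that for every vertex $v$ the set of colors on the edges incident to $v$ is an interval of consecutive integers. -}

module Defs where

open import Data.Nat using (ℕ; zero; suc; _≤_; _<_)
open import Data.Fin using (Fin; zero; suc)
open import Data.Product using (Σ; ∃; _×_; _,_)
open import Data.Sum using (_⊎_)
open import Relation.Binary.PropositionalEquality using (_≡_)
open import Relation.Nullary using (¬_)
open import Relation.Nullary.Decidable using (⌊_⌋)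
open import Data.Bool using (Bool; true; false; _∨_)
open import Data.Fin using (_≟_)

record Multigraph : Set where
  field
    n     : ℕ
    m     : ℕ
    end₁  : Fin m → Fin n
    end₂  : Fin m → Fin n
    loopless : (e : Fin m) → ¬ (end₁ e ≡ end₂ e)

open Multigraph public

Incident : (G : Multigraph) → Fin (m G) → Fin (n G) → Set
Incident G e v = (end₁ G e ≡ v) ⊎ (end₂ G e ≡ v)

incident? : (G : Multigraph) → Fin (m G) → Fin (n G) → Bool
incident? G e v = ⌊ end₁ G e ≟ v ⌋ ∨ ⌊ end₂ G e ≟ v ⌋

countFin : (k : ℕ) → (Fin k → Bool) → ℕ
countFin zero    p = zero
countFin (suc k) p with p zero
... | true  = suc (countFin k (λ i → p (suc i)))
... | false = countFin k (λ i → p (suc i))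

-- degree d_G(v): number of edges incident to v (no loops, so each counts once)
degree : (G : Multigraph) → Fin (n G) → ℕ
degree G v = countFin (m G) (λ e → incident? G e v)

-- The set of colours on edges incident to v is an interval of consecutive
-- integers (the empty set counts as an interval, relevant for isolated vertices).
IsIntervalAt : (G : Multigraph) → (Fin (m G) → ℕ) → Fin (n G) → Set
IsIntervalAt G c v =
  ((e : Fin (m G)) → ¬ Incident G e v)
  ⊎ Σ ℕ (λ a → Σ ℕ (λ b → a ≤ b ×
      ((k : ℕ) → (a ≤ k × k ≤ b) → ∃ (λ e → Incident G e v × c e ≡ k)) ×
      ((e : Fin (m G)) → Incident G e v → a ≤ c e × c e ≤ b)))

record IntervalColoring (G : Multigraph) : Set where
  field
    t        : ℕ
    t-pos    : 1 ≤ t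
    colour   : Fin (m G) → ℕ
    inRange  : (e : Fin (m G)) → 1 ≤ colour e × colour e ≤ t
    allUsed  : (k : ℕ) → 1 ≤ k → k ≤ t → ∃ (λ e → colour e ≡ k)
    proper   : (e f : Fin (m G)) (v : Fin (n G)) → Incident G e v → Incident G f v →
               colour e ≡ colour f → e ≡ f
    interval : (v : Fin (n G)) → IsIntervalAt G colour v

-- Count the edges whose colour is a multiple of d. At a vertex v the colours
-- form an interval of d_G(v) consecutive integers, and d ∣ d_G(v), so exactly
-- d_G(v)/d edges at v have such a colour. Summing over all vertices counts
-- every edge twice, hence twice that number equals Σ_v d_G(v)/d = 2|E(G)|/d,
-- and d divides |E(G)|.
module Submission where

open import Defs
open import Data.Nat using (ℕ; _<_)
open import Data.Nat.Divisibility using (_∣_)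
open import Data.Fin using (Fin)
open import Relation.Nullary using (¬_)

open import Data.Nat.Properties hiding (_≟_; 0≢1+n; suc-injective)
open import Algebra.Properties.Semiring.Sum +-*-semiring
  using (sum-syntax; sum-cong-≗; sum-replicate-zero; ∑-distrib-+; ∑-comm; *-distribˡ-sum; *-distribʳ-sum)
open import Data.Bool using (Bool; true; false; T; _∧_; _∨_)
open import Data.Bool.Properties using (T-∧)
open import Data.Empty using (⊥-elim)
open import Data.Fin using (zero; suc; _≟_)
open import Data.Fin.Properties using (0≢1+n; suc-injective)
open import Data.Nat using (zero; suc; _+_; _*_; _∸_; _≤_; _≡ᵇ_; z≤n; s≤s; z<s) renaming (_≟_ to _≟ℕ_)
open import Data.Nat.Divisibility using (divides; _∣?_; ∣⇒≤; _∣0; ∣-refl; ∣m∣n⇒∣m+n; ∣m+n∣m⇒∣n)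
open import Data.Product using (∃₂; _×_; _,_; proj₂)
open import Data.Sum using (inj₁; inj₂)
open import Data.Unit using (tt)
open import Function using (_∘_; Equivalence)
open import Relation.Nullary using (yes; no; contradiction)
open import Relation.Nullary.Decidable using (⌊_⌋; toWitness; fromWitness)
open import Relation.Binary.PropositionalEquality
open ≡-Reasoning

𝟙 : Bool → ℕ
𝟙 true  = 1
𝟙 false = 0

𝟙-T : ∀ {b} → T b → 𝟙 b ≡ 1
𝟙-T {true}  _ = refl
𝟙-T {false} ()

𝟙-¬T : ∀ {b} → ¬ T b → 𝟙 b ≡ 0
𝟙-¬T {true}  ¬t = contradiction tt ¬t
𝟙-¬T {false} _  = refl

𝟙-∨ : ∀ {x y} → ¬ (T x × T y) → 𝟙 (x ∨ y) ≡ 𝟙 x + 𝟙 y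
𝟙-∨ {true}  {true}  ¬both = contradiction (tt , tt) ¬both
𝟙-∨ {true}  {false} _     = refl
𝟙-∨ {false}         _     = refl

∑𝟙-none : ∀ {k} (p : Fin k → Bool) → (∀ i → ¬ T (p i)) → ∑[ i < k ] 𝟙 (p i) ≡ 0
∑𝟙-none {k} p none = trans (sum-cong-≗ (λ i → 𝟙-¬T (none i))) (sum-replicate-zero k)

∑𝟙-unique : ∀ {k} (p : Fin k → Bool) i → T (p i) → (∀ j → T (p j) → j ≡ i) →
            ∑[ j < k ] 𝟙 (p j) ≡ 1
∑𝟙-unique p zero    pi uniq =
  cong₂ _+_ (𝟙-T pi) (∑𝟙-none (p ∘ suc) (λ j t → 0≢1+n (sym (uniq (suc j) t))))
∑𝟙-unique p (suc i) pi uniq =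
  cong₂ _+_ (𝟙-¬T (λ t → 0≢1+n (uniq zero t)))
            (∑𝟙-unique (p ∘ suc) i pi (λ j t → suc-injective (uniq (suc j) t)))

∑-≟-unique : ∀ {k} (x : Fin k) → ∑[ v < k ] 𝟙 ⌊ x ≟ v ⌋ ≡ 1
∑-≟-unique x = ∑𝟙-unique (λ v → ⌊ x ≟ v ⌋) x (fromWitness refl) (λ v t → sym (toWitness t))

countFin≡∑𝟙 : ∀ k (p : Fin k → Bool) → countFin k p ≡ ∑[ i < k ] 𝟙 (p i)
countFin≡∑𝟙 zero    p = refl
countFin≡∑𝟙 (suc k) p with p zero
... | true  = cong suc (countFin≡∑𝟙 k (p ∘ suc))
... | false = countFin≡∑𝟙 k (p ∘ suc)

∑-one : ∀ k → ∑[ i < k ] 1 ≡ k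
∑-one zero    = refl
∑-one (suc k) = cong suc (∑-one k)

rangeSum : (ℕ → ℕ) → ℕ → ℕ → ℕ
rangeSum h a zero    = 0
rangeSum h a (suc L) = h a + rangeSum h (suc a) L

rangeSum-cong : ∀ {h h′} a L → (∀ j → a ≤ j → j < a + L → h j ≡ h′ j) →
                rangeSum h a L ≡ rangeSum h′ a L
rangeSum-cong a zero    eq = refl
rangeSum-cong a (suc L) eq =
  cong₂ _+_ (eq a ≤-refl (m<m+n a z<s))
            (rangeSum-cong (suc a) L (λ j a<j j<1+a+L →
               eq j (<⇒≤ a<j) (subst (j <_) (sym (+-suc a L)) j<1+a+L)))

rangeSum-0 : ∀ a L → rangeSum (λ _ → 0) a L ≡ 0
rangeSum-0 a zero    = refl
rangeSum-0 a (suc L) = rangeSum-0 (suc a) L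

rangeSum-vanishing : ∀ {h} a L → (∀ j → a ≤ j → j < a + L → h j ≡ 0) → rangeSum h a L ≡ 0
rangeSum-vanishing a L zeros = trans (rangeSum-cong a L zeros) (rangeSum-0 a L)

rangeSum-one : ∀ a L → rangeSum (λ _ → 1) a L ≡ L
rangeSum-one a zero    = refl
rangeSum-one a (suc L) = cong suc (rangeSum-one (suc a) L)

rangeSum-++ : ∀ h a L M → rangeSum h a (L + M) ≡ rangeSum h a L + rangeSum h (a + L) M
rangeSum-++ h a zero    M = cong (λ b → rangeSum h b M) (sym (+-identityʳ a))
rangeSum-++ h a (suc L) M = begin
  h a + rangeSum h (suc a) (L + M)
    ≡⟨ cong (h a +_) (rangeSum-++ h (suc a) L M) ⟩
  h a + (rangeSum h (suc a) L + rangeSum h (suc a + L) M)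
    ≡⟨ sym (+-assoc (h a) _ _) ⟩
  rangeSum h a (suc L) + rangeSum h (suc (a + L)) M
    ≡⟨ cong (λ b → rangeSum h a (suc L) + rangeSum h b M) (sym (+-suc a L)) ⟩
  rangeSum h a (suc L) + rangeSum h (a + suc L) M ∎

rangeSum-snoc : ∀ h a L → rangeSum h a (suc L) ≡ rangeSum h a L + h (a + L)
rangeSum-snoc h a L = begin
  rangeSum h a (suc L)               ≡⟨ cong (rangeSum h a) (+-comm 1 L) ⟩
  rangeSum h a (L + 1)               ≡⟨ rangeSum-++ h a L 1 ⟩
  rangeSum h a L + (h (a + L) + 0)   ≡⟨ cong (rangeSum h a L +_) (+-identityʳ _) ⟩
  rangeSum h a L + h (a + L)         ∎

∑-rangeSum-comm : ∀ {k} (h : Fin k → ℕ → ℕ) a L →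
                  ∑[ i < k ] rangeSum (h i) a L ≡ rangeSum (λ j → ∑[ i < k ] h i j) a L
∑-rangeSum-comm {k} h a zero    = sum-replicate-zero k
∑-rangeSum-comm     h a (suc L) =
  trans (∑-distrib-+ (λ i → h i a) (λ i → rangeSum (h i) (suc a) L))
        (cong (_ +_) (∑-rangeSum-comm h (suc a) L))

rangeSum-pick : ∀ (f : ℕ → ℕ) {j} a L → a ≤ j → j < a + L →
                rangeSum (λ k → f k * 𝟙 (j ≡ᵇ k)) a L ≡ f j
rangeSum-pick f     a zero    a≤j j<a+0 =
  contradiction (≤-trans (≤-reflexive (+-identityʳ a)) a≤j) (<⇒≱ j<a+0)
rangeSum-pick f {j} a (suc L) a≤j j<a+1+L with j ≟ℕ a
... | yes refl = begin
  f j * 𝟙 (j ≡ᵇ j) + rangeSum (λ k → f k * 𝟙 (j ≡ᵇ k)) (suc j) L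
    ≡⟨ cong₂ _+_ (cong (f j *_) (𝟙-T (≡⇒≡ᵇ j j refl)))
                 (rangeSum-vanishing (suc j) L (λ k j<k _ → off k (<⇒≢ j<k))) ⟩
  f j * 1 + 0
    ≡⟨ trans (+-identityʳ _) (*-identityʳ (f j)) ⟩
  f j ∎
  where
  off : ∀ k → j ≢ k → f k * 𝟙 (j ≡ᵇ k) ≡ 0
  off k j≢k = trans (cong (f k *_) (𝟙-¬T (j≢k ∘ ≡ᵇ⇒≡ j k))) (*-zeroʳ (f k))
... | no j≢a = begin
  f a * 𝟙 (j ≡ᵇ a) + rangeSum (λ k → f k * 𝟙 (j ≡ᵇ k)) (suc a) L
    ≡⟨ cong₂ _+_ (trans (cong (f a *_) (𝟙-¬T (j≢a ∘ ≡ᵇ⇒≡ j a))) (*-zeroʳ (f a)))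
                 (rangeSum-pick f (suc a) L (≤∧≢⇒< a≤j (j≢a ∘ sym))
                                (subst (j <_) (+-suc a L) j<a+1+L)) ⟩
  f j ∎

module _ (h : ℕ → ℕ) (p : ℕ) (h-periodic : ∀ k → h (k + p) ≡ h k) where

  rangeSum-shift : ∀ a → rangeSum h (suc a) p ≡ rangeSum h a p
  rangeSum-shift a = +-cancelˡ-≡ (h a) _ _ (begin
    rangeSum h a (suc p)         ≡⟨ rangeSum-snoc h a p ⟩
    rangeSum h a p + h (a + p)   ≡⟨ cong (rangeSum h a p +_) (h-periodic a) ⟩
    rangeSum h a p + h a         ≡⟨ +-comm _ (h a) ⟩
    h a + rangeSum h a p         ∎)

  rangeSum-periodic : ∀ a → rangeSum h a p ≡ rangeSum h 0 p
  rangeSum-periodic zero    = refl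
  rangeSum-periodic (suc a) = trans (rangeSum-shift a) (rangeSum-periodic a)

  rangeSum-periods : ∀ q a → rangeSum h a (q * p) ≡ q * rangeSum h 0 p
  rangeSum-periods zero    a = refl
  rangeSum-periods (suc q) a =
    trans (rangeSum-++ h a p (q * p))
          (cong₂ _+_ (rangeSum-periodic a) (rangeSum-periods q (a + p)))

divisibleBy : ℕ → ℕ → ℕ
divisibleBy d k = 𝟙 ⌊ d ∣? k ⌋

divisibleBy-periodic : ∀ d k → divisibleBy d (k + d) ≡ divisibleBy d k
divisibleBy-periodic d k with d ∣? k | d ∣? (k + d)
... | yes _   | yes _     = refl
... | no _    | no _      = refl
... | yes d∣k | no d∤k+d  = contradiction (∣m∣n⇒∣m+n d∣k ∣-refl) d∤k+d
... | no d∤k  | yes d∣k+d = contradiction (∣m+n∣m⇒∣n (subst (d ∣_) (+-comm k d) d∣k+d) ∣-refl) d∤k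

rangeSum-divisibleBy-initial : ∀ d → rangeSum (divisibleBy (suc d)) 0 (suc d) ≡ 1
rangeSum-divisibleBy-initial d =
  cong₂ _+_ (𝟙-T (fromWitness {a? = suc d ∣? 0} (suc d ∣0))) (rangeSum-vanishing 1 d notMultiple)
  where
  notMultiple : ∀ j → 1 ≤ j → j < suc d → divisibleBy (suc d) j ≡ 0
  notMultiple (suc j) _ j<1+d = 𝟙-¬T (λ t → <⇒≱ j<1+d (∣⇒≤ (toWitness {a? = suc d ∣? suc j} t)))

rangeSum-divisibleBy : ∀ d q a → rangeSum (divisibleBy (suc d)) a (q * suc d) ≡ q
rangeSum-divisibleBy d q a = begin
  rangeSum (divisibleBy (suc d)) a (q * suc d)
    ≡⟨ rangeSum-periods _ (suc d) (divisibleBy-periodic (suc d)) q a ⟩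
  q * rangeSum (divisibleBy (suc d)) 0 (suc d)
    ≡⟨ cong (q *_) (rangeSum-divisibleBy-initial d) ⟩
  q * 1
    ≡⟨ *-identityʳ q ⟩
  q ∎

incident?-sound : ∀ G e v → T (incident? G e v) → Incident G e v
incident?-sound G e v t with end₁ G e ≟ v | end₂ G e ≟ v
... | yes p | _     = inj₁ p
... | no _  | yes q = inj₂ q

incident?-complete : ∀ G e v → Incident G e v → T (incident? G e v)
incident?-complete G e v i with end₁ G e ≟ v | end₂ G e ≟ v | i
... | yes _ | _     | _      = tt
... | no _  | yes _ | _      = tt
... | no ¬p | no _  | inj₁ p = ¬p p
... | no _  | no ¬q | inj₂ q = ¬q q

degree-as-∑ : ∀ G v → degree G v ≡ ∑[ e < m G ] (𝟙 (incident? G e v) * 1)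
degree-as-∑ G v =
  trans (countFin≡∑𝟙 (m G) _) (sum-cong-≗ (λ e → sym (*-identityʳ (𝟙 (incident? G e v)))))

∑-incident : ∀ G e → ∑[ v < n G ] 𝟙 (incident? G e v) ≡ 2
∑-incident G e = begin
  ∑[ v < n G ] 𝟙 (⌊ x ≟ v ⌋ ∨ ⌊ y ≟ v ⌋)
    ≡⟨ sum-cong-≗ (λ v → 𝟙-∨ (notBoth v)) ⟩
  ∑[ v < n G ] (𝟙 ⌊ x ≟ v ⌋ + 𝟙 ⌊ y ≟ v ⌋)
    ≡⟨ ∑-distrib-+ (λ v → 𝟙 ⌊ x ≟ v ⌋) (λ v → 𝟙 ⌊ y ≟ v ⌋) ⟩
  ∑[ v < n G ] 𝟙 ⌊ x ≟ v ⌋ + ∑[ v < n G ] 𝟙 ⌊ y ≟ v ⌋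
    ≡⟨ cong₂ _+_ (∑-≟-unique x) (∑-≟-unique y) ⟩
  2 ∎
  where
  x = end₁ G e
  y = end₂ G e
  notBoth : ∀ v → ¬ (T ⌊ x ≟ v ⌋ × T ⌊ y ≟ v ⌋)
  notBoth v (t₁ , t₂) = loopless G e (trans (toWitness {a? = x ≟ v} t₁) (sym (toWitness {a? = y ≟ v} t₂)))

∑-∑-incident : ∀ G (w : Fin (m G) → ℕ) →
               ∑[ v < n G ] ∑[ e < m G ] (𝟙 (incident? G e v) * w e) ≡ 2 * (∑[ e < m G ] w e)
∑-∑-incident G w = begin
  ∑[ v < n G ] ∑[ e < m G ] (𝟙 (incident? G e v) * w e)
    ≡⟨ ∑-comm (λ v e → 𝟙 (incident? G e v) * w e) ⟩
  ∑[ e < m G ] ∑[ v < n G ] (𝟙 (incident? G e v) * w e)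
    ≡⟨ sum-cong-≗ (λ e → trans (sym (*-distribʳ-sum (w e) (λ v → 𝟙 (incident? G e v))))
                               (cong (_* w e) (∑-incident G e))) ⟩
  ∑[ e < m G ] (2 * w e)
    ≡⟨ sym (*-distribˡ-sum 2 w) ⟩
  2 * (∑[ e < m G ] w e) ∎

handshake : ∀ G → ∑[ v < n G ] degree G v ≡ 2 * m G
handshake G = begin
  ∑[ v < n G ] degree G v                               ≡⟨ sum-cong-≗ (degree-as-∑ G) ⟩
  ∑[ v < n G ] ∑[ e < m G ] (𝟙 (incident? G e v) * 1)   ≡⟨ ∑-∑-incident G (λ _ → 1) ⟩
  2 * (∑[ e < m G ] 1)                                  ≡⟨ cong (2 *_) (∑-one (m G)) ⟩
  2 * m G                                               ∎

module _ {G : Multigraph} (γ : IntervalColoring G) where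
  open IntervalColoring γ

  incidentSum : Fin (n G) → (ℕ → ℕ) → ℕ
  incidentSum v f = ∑[ e < m G ] (𝟙 (incident? G e v) * f (colour e))

  incidentWithColour? : Fin (n G) → ℕ → Fin (m G) → Bool
  incidentWithColour? v k e = incident? G e v ∧ (colour e ≡ᵇ k)

  multiplicity : Fin (n G) → ℕ → ℕ
  multiplicity v k = ∑[ e < m G ] 𝟙 (incidentWithColour? v k e)

  private
    decode : ∀ {v k e} → T (incidentWithColour? v k e) → Incident G e v × colour e ≡ k
    decode {v} {k} {e} t with Equivalence.to (T-∧ {incident? G e v} {colour e ≡ᵇ k}) t
    ... | t₁ , t₂ = incident?-sound G e v t₁ , ≡ᵇ⇒≡ (colour e) k t₂

    encode : ∀ {v k e} → Incident G e v → colour e ≡ k → T (incidentWithColour? v k e)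
    encode {v} {k} {e} i c≡k =
      Equivalence.from (T-∧ {incident? G e v} {colour e ≡ᵇ k})
                       (incident?-complete G e v i , ≡⇒≡ᵇ (colour e) k c≡k)

  multiplicity≡0 : ∀ v k → (∀ e → Incident G e v → colour e ≢ k) → multiplicity v k ≡ 0
  multiplicity≡0 v k avoid = ∑𝟙-none _ (λ e t → let (i , c≡k) = decode t in avoid e i c≡k)

  multiplicity≡1 : ∀ v k e → Incident G e v → colour e ≡ k → multiplicity v k ≡ 1
  multiplicity≡1 v k e i c≡k = ∑𝟙-unique _ e (encode i c≡k) (λ e′ t →
    let (i′ , c′≡k) = decode t in proper e′ e v i′ i (trans c′≡k (sym c≡k)))

  incidentSum-expand : ∀ v B f → (∀ e → Incident G e v → colour e < B) →
                       incidentSum v f ≡ rangeSum (λ k → f k * multiplicity v k) 0 B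
  incidentSum-expand v B f bounded = begin
    incidentSum v f
      ≡⟨ sum-cong-≗ edgeTerm ⟩
    ∑[ e < m G ] rangeSum (λ k → f k * 𝟙 (incidentWithColour? v k e)) 0 B
      ≡⟨ ∑-rangeSum-comm (λ e k → f k * 𝟙 (incidentWithColour? v k e)) 0 B ⟩
    rangeSum (λ k → ∑[ e < m G ] (f k * 𝟙 (incidentWithColour? v k e))) 0 B
      ≡⟨ rangeSum-cong 0 B (λ k _ _ → sym (*-distribˡ-sum (f k) (𝟙 ∘ incidentWithColour? v k))) ⟩
    rangeSum (λ k → f k * multiplicity v k) 0 B ∎
    where
    edgeTerm : ∀ e → 𝟙 (incident? G e v) * f (colour e)
                   ≡ rangeSum (λ k → f k * 𝟙 (incidentWithColour? v k e)) 0 B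
    edgeTerm e with incident? G e v in eq
    ... | true  = trans (+-identityʳ _)
                        (sym (rangeSum-pick f 0 B z≤n (bounded e (incident?-sound G e v (subst T (sym eq) tt)))))
    ... | false = sym (rangeSum-vanishing 0 B (λ k _ _ → *-zeroʳ (f k)))

  incidentSum-interval : ∀ v → ∃₂ λ a L → ∀ f → incidentSum v f ≡ rangeSum f a L
  incidentSum-interval v with interval v
  ... | inj₁ isolated = 0 , 0 , λ f → incidentSum-expand v 0 f (λ e i → ⊥-elim (isolated e i))
  ... | inj₂ (a , b , a≤b , covered , bounded) = a , L , onInterval
    where
    L = suc b ∸ a
    a+L≡1+b : a + L ≡ suc b
    a+L≡1+b = m+[n∸m]≡n (m≤n⇒m≤1+n a≤b)
    onInterval : ∀ f → incidentSum v f ≡ rangeSum f a L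
    onInterval f = begin
      incidentSum v f
        ≡⟨ incidentSum-expand v (a + L) f
             (λ e i → subst (colour e <_) (sym a+L≡1+b) (s≤s (proj₂ (bounded e i)))) ⟩
      rangeSum h 0 (a + L)
        ≡⟨ rangeSum-++ h 0 a L ⟩
      rangeSum h 0 a + rangeSum h a L
        ≡⟨ cong₂ _+_ (rangeSum-vanishing 0 a below) (rangeSum-cong a L inside) ⟩
      rangeSum f a L ∎
      where
      h = λ k → f k * multiplicity v k
      below : ∀ k → 0 ≤ k → k < 0 + a → h k ≡ 0
      below k _ k<a = trans (cong (f k *_) (multiplicity≡0 v k (λ e i c≡k →
        let (a≤c , _) = bounded e i in <⇒≱ k<a (subst (a ≤_) c≡k a≤c)))) (*-zeroʳ (f k))
      inside : ∀ k → a ≤ k → k < a + L → h k ≡ f k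
      inside k a≤k k<a+L with covered k (a≤k , ≤-pred (subst (k <_) a+L≡1+b k<a+L))
      ... | e , i , c≡k = trans (cong (f k *_) (multiplicity≡1 v k e i c≡k)) (*-identityʳ (f k))

  incidentSum-divisibleBy : ∀ d v → suc d ∣ degree G v →
                            incidentSum v (divisibleBy (suc d)) * suc d ≡ degree G v
  incidentSum-divisibleBy d v (divides q deg≡) with incidentSum-interval v
  ... | a , L , sum≡ = begin
    incidentSum v g * suc d            ≡⟨ cong (_* suc d) (sum≡ g) ⟩
    rangeSum g a L * suc d             ≡⟨ cong (λ ℓ → rangeSum g a ℓ * suc d) L≡q*d ⟩
    rangeSum g a (q * suc d) * suc d   ≡⟨ cong (_* suc d) (rangeSum-divisibleBy d q a) ⟩
    q * suc d                          ≡⟨ sym deg≡ ⟩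
    degree G v                         ∎
    where
    g = divisibleBy (suc d)
    L≡q*d : L ≡ q * suc d
    L≡q*d = begin
      L                         ≡⟨ sym (rangeSum-one a L) ⟩
      rangeSum (λ _ → 1) a L    ≡⟨ sym (sum≡ (λ _ → 1)) ⟩
      incidentSum v (λ _ → 1)   ≡⟨ sym (degree-as-∑ G v) ⟩
      degree G v                ≡⟨ deg≡ ⟩
      q * suc d                 ∎

mainTheorem18 : (G : Multigraph) (d : ℕ) → 0 < d →
    ((v : Fin (n G)) → d ∣ degree G v) → ¬ (d ∣ m G) →
    ¬ IntervalColoring G
mainTheorem18 G (suc d) _ d∣degree d∤m γ = d∤m (divides E (*-cancelˡ-≡ (m G) (E * suc d) 2 twice))
  where
  open IntervalColoring γ
  g = divisibleBy (suc d)
  E = ∑[ e < m G ] g (colour e)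
  twice : 2 * m G ≡ 2 * (E * suc d)
  twice = begin
    2 * m G
      ≡⟨ sym (handshake G) ⟩
    ∑[ v < n G ] degree G v
      ≡⟨ sum-cong-≗ (λ v → sym (incidentSum-divisibleBy γ d v (d∣degree v))) ⟩
    ∑[ v < n G ] (incidentSum γ v g * suc d)
      ≡⟨ sym (*-distribʳ-sum (suc d) (λ v → incidentSum γ v g)) ⟩
    (∑[ v < n G ] incidentSum γ v g) * suc d
      ≡⟨ cong (_* suc d) (∑-∑-incident G (g ∘ colour)) ⟩
    2 * E * suc d
      ≡⟨ *-assoc 2 E (suc d) ⟩
    2 * (E * suc d) ∎
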